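{- Let $N,k,p,t\in\{1,2,\dots\}$ with $t\ge 2$ and $N>k$, $N>p$. Let $D$ be the following graph. It has vertices $v$ and $z$, a path $v,x_1,x_2,\dots,x_{N-k},z$ where for each $i\in\{1,\dots,N-k\}$ the vertex $x_i$ has $k+i-1$ suspended paths attached, and a path $v,y_1,\dots,y_{N-p},z$ where for each $i\in\{1,\dots,N-p\}$ the vertex $y_i$ has $p+i-1$ suspended paths attached; the vertex $v$ has $t-2$ pendant vertices and two suspended paths attached; and for each $i\in\{1,\dots,N\}$ there is a type-A $(N+i)$-disallowing gadget at $z$, namely two new vertices $a_i,b_i$ with edges $za_i$, $zb_i$, $a_ib_i$, where each of $a_i$ and $b_i$ has $N+i-1$ suspended paths attached. (All these added vertices are distinct.) Suppose $D$ is an induced subgraph of a graph $H$ such that every edge between $V(D)$ and $V(H)\setminus V(D)$ has its endpoint in $V(D)$ in $\{v,z\}$, and $d_H(z)\le 3N$. Let $w:E(H)\to\{0,1\}$ be a proper weight function of $H$. Then $w(vx_1)=w(vy_1)=0$, $\mathrm{color}_w(x_1)=k$ and $\mathrm{color}_w(y_1)=p$.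
   Context: Graphs are finite, simple, undirected. For $w:E(H)\to\{0,1\}$, $\mathrm{color}_w(u)=\sum_{e\ni u}w(e)$; $w$ is proper if $\mathrm{color}_w(u)\neq\mathrm{color}_w(u')$ for every edge $uu'$. Attaching a suspended path at a vertex $a$ means adding two new vertices $c,d$ and edges $ac$, $cd$, where $c,d$ have no other neighbors. A pendant vertex attached to $a$ is a new vertex adjacent only to $a$. -}

module Defs where

open import Data.Nat using (ℕ; zero; suc; _+_; _*_; _∸_; _≤_; _<_)
open import Data.Fin using (Fin; toℕ)
open import Data.Bool using (Bool; true; false; if_then_else_)
open import Data.List using (List; map; allFin)
open import Data.Nat.ListAction using (sum)
open import Data.Sum using (_⊎_)
open import Data.Product using (_×_)
open import Relation.Binary.PropositionalEquality using (_≡_; _≢_)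
open import Relation.Nullary using (¬_)
open import Function.Definitions using (Injective)

record Graph : Set where
  field
    n     : ℕ
    adj   : Fin n → Fin n → Bool
    sym   : ∀ u v → adj u v ≡ adj v u
    irrefl : ∀ u → adj u u ≡ false
open Graph public

deg : (H : Graph) → Fin (n H) → ℕ
deg H u = sum (map (λ v → if adj H u v then 1 else 0) (allFin (n H)))

-- A {0,1}-weight function on the edges of H, represented as a symmetric
-- function on pairs of vertices with values ≤ 1 (values on non-edges are
-- irrelevant: they never enter colour sums).
record Weight (H : Graph) : Set where
  field
    w     : Fin (n H) → Fin (n H) → ℕ
    w-sym : ∀ u v → w u v ≡ w v u
    w≤1   : ∀ u v → w u v ≤ 1
open Weight public

color : (H : Graph) → Weight H → Fin (n H) → ℕ
color H ω u = sum (map (λ v → if adj H u v then w ω u v else 0) (allFin (n H)))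

Proper : (H : Graph) → Weight H → Set
Proper H ω = ∀ u u' → adj H u u' ≡ true → color H ω u ≢ color H ω u'

-- Indices are 0-based:
--   x i  (i : Fin (N ∸ k))  is x_{i+1},  it carries k + i suspended paths
--                            (= k + (i+1) - 1), the j-th being x i — xc i j — xd i j;
--   y i  (i : Fin (N ∸ p))  is y_{i+1},  it carries p + i suspended paths;
--   vp j (j : Fin (t ∸ 2))  are the t-2 pendant vertices at v;
--   vc j, vd j (j : Fin 2)  are the two suspended paths at v;
--   a i, b i (i : Fin N)    form the type-A (N+i+1)-disallowing gadget, and
--                            each of a i, b i carries N + i suspended paths.

data DV (N k p t : ℕ) : Set where
  v z : DV N k p t
  x   : Fin (N ∸ k) → DV N k p t
  xc xd : (i : Fin (N ∸ k)) → Fin (k + toℕ i) → DV N k p t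
  y   : Fin (N ∸ p) → DV N k p t
  yc yd : (i : Fin (N ∸ p)) → Fin (p + toℕ i) → DV N k p t
  vp  : Fin (t ∸ 2) → DV N k p t
  vc vd : Fin 2 → DV N k p t
  a b : Fin N → DV N k p t
  ac ad bc bd : (i : Fin N) → Fin (N + toℕ i) → DV N k p t

data DE {N k p t : ℕ} : DV N k p t → DV N k p t → Set where
  e-vx  : (i : Fin (N ∸ k)) → toℕ i ≡ 0 → DE v (x i)
  e-xx  : (i j : Fin (N ∸ k)) → suc (toℕ i) ≡ toℕ j → DE (x i) (x j)
  e-xz  : (i : Fin (N ∸ k)) → suc (toℕ i) ≡ N ∸ k → DE (x i) z
  e-xc  : (i : Fin (N ∸ k)) (j : Fin (k + toℕ i)) → DE (x i) (xc i j)
  e-xcd : (i : Fin (N ∸ k)) (j : Fin (k + toℕ i)) → DE (xc i j) (xd i j)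
  e-vy  : (i : Fin (N ∸ p)) → toℕ i ≡ 0 → DE v (y i)
  e-yy  : (i j : Fin (N ∸ p)) → suc (toℕ i) ≡ toℕ j → DE (y i) (y j)
  e-yz  : (i : Fin (N ∸ p)) → suc (toℕ i) ≡ N ∸ p → DE (y i) z
  e-yc  : (i : Fin (N ∸ p)) (j : Fin (p + toℕ i)) → DE (y i) (yc i j)
  e-ycd : (i : Fin (N ∸ p)) (j : Fin (p + toℕ i)) → DE (yc i j) (yd i j)
  e-vp  : (j : Fin (t ∸ 2)) → DE v (vp j)
  e-vc  : (j : Fin 2) → DE v (vc j)
  e-vcd : (j : Fin 2) → DE (vc j) (vd j)
  e-za  : (i : Fin N) → DE z (a i)
  e-zb  : (i : Fin N) → DE z (b i)
  e-ab  : (i : Fin N) → DE (a i) (b i)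
  e-ac  : (i : Fin N) (j : Fin (N + toℕ i)) → DE (a i) (ac i j)
  e-acd : (i : Fin N) (j : Fin (N + toℕ i)) → DE (ac i j) (ad i j)
  e-bc  : (i : Fin N) (j : Fin (N + toℕ i)) → DE (b i) (bc i j)
  e-bcd : (i : Fin N) (j : Fin (N + toℕ i)) → DE (bc i j) (bd i j)

DAdj : {N k p t : ℕ} → DV N k p t → DV N k p t → Set
DAdj u u' = DE u u' ⊎ DE u' u

record AttachedInduced (N k p t : ℕ) (H : Graph) (f : DV N k p t → Fin (n H)) : Set where
  field
    inj      : Injective _≡_ _≡_ f
    adj→D    : ∀ u u' → adj H (f u) (f u') ≡ true → DAdj u u'
    D→adj    : ∀ u u' → DAdj u u' → adj H (f u) (f u') ≡ true
    boundary : ∀ (u : DV N k p t) (h : Fin (n H)) →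
               (∀ u' → f u' ≢ h) → adj H (f u) h ≡ true → (u ≡ v) ⊎ (u ≡ z)

{-# OPTIONS --safe #-}
module Submission where

-- A suspended path u–c–d forces w(uc) = 1, since otherwise c and d would both
-- have color w(cd); so a vertex of D other than v, z that carries r suspended
-- paths has color r plus the weights of its two remaining edges.  In the gadget
-- for i ∈ {1, …, N}, properness on a_i b_i forces w(z a_i) + w(z b_i) = 1, and
-- a_i, b_i then have the colors γ + N + i - 1 and γ + N + i (γ = w(a_i b_i)) in
-- some order, so z cannot have color N + i.  The gadgets contribute exactly N
-- to the color of z and the degree bound caps it at 2N, which leaves color N
-- and weight 0 on every other edge at z.  Along the arm v, x_1, …, x_{N-k}, z
-- the color of x_{m+1} is k + m plus the weights of its two arm edges; going
-- down from z, an arm edge of weight 1 would give two consecutive vertices equal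
-- colors, so all arm edges have weight 0 and x_1 has color k.  Exchanging the
-- two arms is an isomorphism of D fixing v and z, which yields the claims for y_1.

open import Defs hiding (sym)
open import Algebra.Properties.CommutativeSemigroup using (interchange)
open import Data.Nat
  using (ℕ; zero; suc; _+_; _*_; _∸_; _≤_; _<_; _≤‴_; ≤‴-refl; ≤‴-step; z≤n; s≤s; s≤s⁻¹; _<?_; _≤?_)
open import Data.Nat.Properties
  using ( +-mono-≤; +-monoˡ-≤; +-monoʳ-≤; +-assoc; +-comm; +-suc; +-identityʳ; *-identityʳ; *-zeroʳ
        ; +-cancelʳ-≤; +-cancelˡ-<; m≤m+n; m≤n+m; ≤-refl; ≤-trans; ≤-antisym; <-irrefl; <⇒≤; ≮⇒≥; ≰⇒>
        ; n≤1⇒n≡0∨n≡1; n≤0⇒n≡0; m<n⇒0<n∸m; m+[n∸m]≡n; m≢1+n+m; ≤⇒≤‴; ≤‴⇒≤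
        ; +-commutativeSemigroup; module ≤-Reasoning )
open import Data.Nat.Tactic.RingSolver using (solve-∀)
open import Data.Fin using (Fin; toℕ; fromℕ<) renaming (_≟_ to _≟ᶠ_)
open import Data.Fin.Properties using (toℕ<n; toℕ-fromℕ<; fromℕ<-toℕ)
open import Data.Bool using (Bool; true; false; if_then_else_)
open import Data.List using (List; []; _∷_; _++_; map; filter; allFin; tabulate; length)
open import Data.List.Properties using (map-++; map-∘; map-cong-local; length-map; length-++; length-tabulate)
open import Data.Nat.ListAction using (sum)
open import Data.Nat.ListAction.Properties using (sum-++; sum-↭)
open import Data.List.Relation.Unary.All as All using (All; []; _∷_)
import Data.List.Relation.Unary.All.Properties as All
open import Data.List.Relation.Unary.Any using (here; there)
open import Data.List.Relation.Unary.AllPairs using ([]; _∷_)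
open import Data.List.Relation.Unary.Unique.Propositional using (Unique)
import Data.List.Relation.Unary.Unique.Propositional.Properties as Unique
open import Data.List.Membership.Propositional using (_∈_)
open import Data.List.Membership.Propositional.Properties
  using (∈-allFin; ∈-filter⁺; ∈-filter⁻; ∈-++⁺ˡ; ∈-++⁺ʳ; ∈-map⁺; ∈-map⁻; ∈-tabulate⁺)
open import Data.List.Membership.Propositional.Properties.WithK using (unique∧set⇒bag)
import Data.List.Membership.DecPropositional as DecMembership
open import Data.List.Relation.Binary.BagAndSetEquality using (∼bag⇒↭)
open import Data.List.Relation.Binary.Permutation.Propositional using (_↭_)
import Data.List.Relation.Binary.Permutation.Propositional.Properties as ↭
open import Data.Product using (_×_; _,_; proj₁; proj₂)
open import Data.Sum as Sum using (inj₁; inj₂)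
open import Data.Empty using (⊥; ⊥-elim)
open import Data.Unit using (⊤)
open import Function using (_∘_; id)
open import Function.Bundles using (mk⇔)
open import Relation.Nullary using (¬_; yes; no; ¬?)
open import Relation.Binary.PropositionalEquality
  using (_≡_; _≢_; refl; sym; trans; cong; cong₂; subst; subst₂; module ≡-Reasoning)

module _ {A : Set} {f : A → ℕ} where

  sum-map-const : ∀ {c} {xs : List A} → All (λ u → f u ≡ c) xs → sum (map f xs) ≡ length xs * c
  sum-map-const []            = refl
  sum-map-const (fu≡c ∷ rest) = cong₂ _+_ fu≡c (sum-map-const rest)

  sum-map-+ : ∀ {g : A → ℕ} xs → sum (map f xs) + sum (map g xs) ≡ sum (map (λ u → f u + g u) xs)
  sum-map-+         []       = refl
  sum-map-+ {g = g} (u ∷ xs) =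
    trans (interchange +-commutativeSemigroup (f u) (sum (map f xs)) (g u) (sum (map g xs)))
          (cong (f u + g u +_) (sum-map-+ xs))

  sum-map-mono : ∀ {g : A → ℕ} → (∀ u → f u ≤ g u) → ∀ xs → sum (map f xs) ≤ sum (map g xs)
  sum-map-mono f≤g []       = z≤n
  sum-map-mono f≤g (u ∷ xs) = +-mono-≤ (f≤g u) (sum-map-mono f≤g xs)

-- Colors and degrees in a graph

module _ {n : ℕ} where

  open DecMembership (_≟ᶠ_ {n}) using (_∈?_)

  outside : List (Fin n) → List (Fin n)
  outside L = filter (λ h → ¬? (h ∈? L)) (allFin n)

  ∈-outside⁻ : ∀ {L h} → h ∈ outside L → ¬ h ∈ L
  ∈-outside⁻ {L} = proj₂ ∘ ∈-filter⁻ (λ h → ¬? (h ∈? L)) {xs = allFin n}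

  allFin-↭ : ∀ {L} → Unique L → allFin n ↭ L ++ outside L
  allFin-↭ {L} uniqL = ∼bag⇒↭ (unique∧set⇒bag (Unique.allFin⁺ n) uniqueRHS (mk⇔ into (λ _ → ∈-allFin _)))
    where
    uniqueRHS : Unique (L ++ outside L)
    uniqueRHS = Unique.++⁺ uniqL (Unique.filter⁺ _ (Unique.allFin⁺ n)) (λ (h∈L , h∈out) → ∈-outside⁻ h∈out h∈L)
    into : ∀ {h} → h ∈ allFin n → h ∈ L ++ outside L
    into {h} _ with h ∈? L
    ... | yes h∈L = ∈-++⁺ˡ h∈L
    ... | no  h∉L = ∈-++⁺ʳ L (∈-filter⁺ _ (∈-allFin h) h∉L)

  sum-allFin-split : ∀ {L} → Unique L → (g : Fin n → ℕ) →
                     sum (map g (allFin n)) ≡ sum (map g L) + sum (map g (outside L))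
  sum-allFin-split {L} uniqL g =
    trans (sum-↭ (↭.map⁺ g (allFin-↭ uniqL)))
          (trans (cong sum (map-++ g L (outside L))) (sum-++ (map g L) (map g (outside L))))

Adj : (H : Graph) → Fin (n H) → Fin (n H) → Set
Adj H u h = adj H u h ≡ true

record ExactNeighbours {A : Set} (R : A → A → Set) (u : A) (L : List A) : Set where
  field
    distinct : Unique L
    adjacent : All (R u) L
    complete : ∀ {u′} → R u u′ → u′ ∈ L

module _ (H : Graph) (ω : Weight H) {u : Fin (n H)} {L : List (Fin (n H))} where

  private
    weightAt edgeAt : Fin (n H) → ℕ
    weightAt h = if adj H u h then w ω u h else 0
    edgeAt   h = if adj H u h then 1 else 0

    weightAt≤edgeAt : ∀ h → weightAt h ≤ edgeAt h
    weightAt≤edgeAt h with adj H u h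
    ... | true  = w≤1 ω u h
    ... | false = z≤n

    color-split : Unique L → All (Adj H u) L →
                  color H ω u ≡ sum (map (w ω u) L) + sum (map weightAt (outside L))
    color-split uniqL adjL = trans (sum-allFin-split uniqL weightAt)
      (cong (λ ws → sum ws + sum (map weightAt (outside L)))
            (map-cong-local (All.map (cong (if_then _ else 0)) adjL)))

    deg-split : Unique L → All (Adj H u) L → deg H u ≡ length L + sum (map edgeAt (outside L))
    deg-split uniqL adjL = trans (sum-allFin-split uniqL edgeAt)
      (cong (_+ sum (map edgeAt (outside L)))
        (trans (sum-map-const (All.map (cong (if_then 1 else 0)) adjL)) (*-identityʳ (length L))))

  weights≤color : Unique L → All (Adj H u) L → sum (map (w ω u) L) ≤ color H ω u
  weights≤color uniqL adjL rewrite color-split uniqL adjL = m≤m+n _ _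

  color+length≤weights+deg : Unique L → All (Adj H u) L →
                             color H ω u + length L ≤ sum (map (w ω u) L) + deg H u
  color+length≤weights+deg uniqL adjL = begin
    color H ω u + length L      ≡⟨ cong (_+ length L) (color-split uniqL adjL) ⟩
    S + R + length L            ≡⟨ +-assoc S R (length L) ⟩
    S + (R + length L)          ≡⟨ cong (S +_) (+-comm R (length L)) ⟩
    S + (length L + R)          ≤⟨ +-monoʳ-≤ S (+-monoʳ-≤ (length L) (sum-map-mono weightAt≤edgeAt (outside L))) ⟩
    S + (length L + R′)         ≡⟨ cong (S +_) (sym (deg-split uniqL adjL)) ⟩
    S + deg H u                 ∎
    where
    open ≤-Reasoning
    S = sum (map (w ω u) L)
    R = sum (map weightAt (outside L))
    R′ = sum (map edgeAt (outside L))

  color-exact : ExactNeighbours (Adj H) u L → color H ω u ≡ sum (map (w ω u) L)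
  color-exact exact =
    trans (color-split distinct adjacent) (trans (cong (sum (map (w ω u) L) +_) rest≡0) (+-identityʳ _))
    where
    open ExactNeighbours exact
    nonNeighbour : ∀ {h} → h ∈ outside L → weightAt h ≡ 0
    nonNeighbour {h} h∈out with adj H u h in uh
    ... | true  = ⊥-elim (∈-outside⁻ h∈out (complete uh))
    ... | false = refl
    rest≡0 : sum (map weightAt (outside L)) ≡ 0
    rest≡0 = trans (sum-map-const (All.tabulate nonNeighbour)) (*-zeroʳ (length (outside L)))

gadget-arith : ∀ {α β γ s c} → α ≤ 1 → β ≤ 1 → γ ≤ 1 →
               α + γ + s ≢ β + γ + s → c ≢ α + γ + s → c ≢ β + γ + s →
               α + β ≡ 1 × c ≢ suc s
gadget-arith α≤1 β≤1 γ≤1 a≢b c≢a c≢b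
  with n≤1⇒n≡0∨n≡1 α≤1 | n≤1⇒n≡0∨n≡1 β≤1 | n≤1⇒n≡0∨n≡1 γ≤1
... | inj₁ refl | inj₁ refl | _         = ⊥-elim (a≢b refl)
... | inj₂ refl | inj₂ refl | _         = ⊥-elim (a≢b refl)
... | inj₁ refl | inj₂ refl | inj₁ refl = refl , c≢b
... | inj₁ refl | inj₂ refl | inj₂ refl = refl , c≢a
... | inj₂ refl | inj₁ refl | inj₁ refl = refl , c≢a
... | inj₂ refl | inj₁ refl | inj₂ refl = refl , c≢b

below-gap : ∀ {N c} → c ≤ N + N → (∀ (i : Fin N) → c ≢ suc (N + toℕ i)) → c ≤ N
below-gap {N} {c} c≤2N avoid with c ≤? N
... | yes c≤N = c≤N
... | no  c≰N =
  ⊥-elim (avoid (fromℕ< r<N) (sym (trans (cong (λ r′ → suc (N + r′)) (toℕ-fromℕ< r<N)) N+1+r≡c)))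
  where
  r = c ∸ suc N
  N+1+r≡c : suc (N + r) ≡ c
  N+1+r≡c = m+[n∸m]≡n (≰⇒> c≰N)
  r<N : r < N
  r<N = +-cancelˡ-< (suc N) r N (subst (_< suc (N + N)) (sym N+1+r≡c) (s≤s c≤2N))

weights-vanish-along-path :
  ∀ {k M} (e col : ℕ → ℕ) → (∀ m → e m ≤ 1) →
  (∀ m → m < M → col m ≡ e m + e (suc m) + (k + m)) →
  (∀ m → m < M → col m ≢ col (suc m)) →
  e M ≡ 0 → col M ≡ k + M →
  ∀ {m} → m ≤ M → e m ≡ 0 × col m ≡ k + m
weights-vanish-along-path {k} {M} e col e≤1 col-path col-proper eM≡0 colM = descend ∘ ≤⇒≤‴
  where
  descend : ∀ {m} → m ≤‴ M → e m ≡ 0 × col m ≡ k + m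
  descend ≤‴-refl = eM≡0 , colM
  descend {m} (≤‴-step 1+m≤M) with descend 1+m≤M | n≤1⇒n≡0∨n≡1 (e≤1 m)
  ... | e₁≡0 , col₁ | inj₁ e₀≡0 =
    e₀≡0 , trans (col-path m m<M) (cong₂ (λ α β → α + β + (k + m)) e₀≡0 e₁≡0)
    where m<M = ≤‴⇒≤ 1+m≤M
  ... | e₁≡0 , col₁ | inj₂ e₀≡1 =
    ⊥-elim (col-proper m m<M (trans (col-path m m<M)
      (trans (cong₂ (λ α β → α + β + (k + m)) e₀≡1 e₁≡0) (trans (sym (+-suc k m)) (sym col₁)))))
    where m<M = ≤‴⇒≤ 1+m≤M

-- The graph D

module _ {N k p t : ℕ} where

  ExactNeighboursᴰ : DV N k p t → List (DV N k p t) → Set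
  ExactNeighboursᴰ = ExactNeighbours DAdj

  -- By `boundary`, these vertices have the same neighbourhood in H as in D.
  Interior : DV N k p t → Set
  Interior v = ⊥
  Interior z = ⊥
  Interior _ = ⊤

  -- The path v, x₁, …, x_{N-k}, z, indexed from 0; past its end it stays at z.
  xPath : ℕ → DV N k p t
  xPath zero = v
  xPath (suc m) with m <? N ∸ k
  ... | yes m<M = x (fromℕ< m<M)
  ... | no  _   = z

  onXPath : DV N k p t → Bool
  onXPath v     = true
  onXPath z     = true
  onXPath (x _) = true
  onXPath _     = false

  onXPath-xPath : ∀ m → onXPath (xPath m) ≡ true
  onXPath-xPath zero = refl
  onXPath-xPath (suc m) with m <? N ∸ k
  ... | yes _ = refl
  ... | no  _ = refl

  xPath-≢ : ∀ m {u} → onXPath u ≡ false → xPath m ≢ u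
  xPath-≢ m off refl with trans (sym (onXPath-xPath m)) off
  ... | ()

  xPosition : DV N k p t → ℕ
  xPosition (x i) = suc (toℕ i)
  xPosition z     = suc (N ∸ k)
  xPosition _     = 0

  xPosition-xPath : ∀ m → m ≤ suc (N ∸ k) → xPosition (xPath m) ≡ m
  xPosition-xPath zero _ = refl
  xPosition-xPath (suc m) m<1+M with m <? N ∸ k
  ... | yes m<M = cong suc (toℕ-fromℕ< m<M)
  ... | no  m≮M = cong suc (≤-antisym (≮⇒≥ m≮M) (s≤s⁻¹ m<1+M))

  xPath-x : (i : Fin (N ∸ k)) → xPath (suc (toℕ i)) ≡ x i
  xPath-x i with toℕ i <? N ∸ k
  ... | yes i<M = cong x (fromℕ<-toℕ i i<M)
  ... | no  i≮M = ⊥-elim (i≮M (toℕ<n i))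

  xPath-end : xPath (suc (N ∸ k)) ≡ z
  xPath-end with N ∸ k <? N ∸ k
  ... | yes M<M = ⊥-elim (<-irrefl refl M<M)
  ... | no  _   = refl

  xPath-adjacent : 0 < N ∸ k → ∀ m → m ≤ N ∸ k → DAdj (xPath m) (xPath (suc m))
  xPath-adjacent 0<M zero _ with 0 <? N ∸ k
  ... | yes 0<M′ = inj₁ (e-vx _ (toℕ-fromℕ< 0<M′))
  ... | no  0≮M  = ⊥-elim (0≮M 0<M)
  xPath-adjacent _ (suc m) m<M with m <? N ∸ k
  ... | no  m≮M = ⊥-elim (m≮M m<M)
  ... | yes m<M′ with suc m <? N ∸ k
  ...   | yes m+1<M = inj₁ (e-xx _ _ (trans (cong suc (toℕ-fromℕ< m<M′)) (sym (toℕ-fromℕ< m+1<M))))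
  ...   | no  m+1≮M = inj₁ (e-xz _ (trans (cong suc (toℕ-fromℕ< m<M′)) (≤-antisym m<M (≮⇒≥ m+1≮M))))

  x-neighbours : (i : Fin (N ∸ k)) →
                 ExactNeighboursᴰ (x i) (xPath (toℕ i) ∷ xPath (suc (suc (toℕ i))) ∷ tabulate (xc i))
  x-neighbours i = record
    { distinct = (prev≢next ∷ All.tabulate⁺ (λ _ → xPath-≢ (toℕ i) refl))
               ∷ All.tabulate⁺ (λ _ → xPath-≢ (suc (suc (toℕ i))) refl)
               ∷ Unique.tabulate⁺ λ { refl → refl }
    ; adjacent = Sum.swap (subst (DAdj (xPath (toℕ i))) (xPath-x i)
                                 (xPath-adjacent 0<M (toℕ i) (<⇒≤ i<M)))
               ∷ subst (λ u → DAdj u (xPath (suc (suc (toℕ i))))) (xPath-x i)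
                       (xPath-adjacent 0<M (suc (toℕ i)) i<M)
               ∷ All.tabulate⁺ (λ j → inj₁ (e-xc i j))
    ; complete = λ
        { (inj₁ (e-xx _ j i+1≡j)) → there (here (trans (sym (xPath-x j)) (cong (xPath ∘ suc) (sym i+1≡j))))
        ; (inj₁ (e-xz _ i+1≡M))   → there (here (trans (sym xPath-end) (cong (xPath ∘ suc) (sym i+1≡M))))
        ; (inj₁ (e-xc _ j))       → there (there (∈-tabulate⁺ j))
        ; (inj₂ (e-vx _ i≡0))     → here (cong xPath (sym i≡0))
        ; (inj₂ (e-xx j _ j+1≡i)) → here (trans (sym (xPath-x j)) (cong xPath j+1≡i))
        }
    }
    where
    i<M = toℕ<n i
    0<M = ≤-trans (s≤s z≤n) i<M
    prev≢next : xPath (toℕ i) ≢ xPath (suc (suc (toℕ i)))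
    prev≢next e = m≢1+n+m (toℕ i) (begin
      toℕ i                              ≡⟨ sym (xPosition-xPath (toℕ i) (≤-trans (<⇒≤ i<M) (m≤n+m _ 1))) ⟩
      xPosition (xPath (toℕ i))          ≡⟨ cong xPosition e ⟩
      xPosition (xPath (suc (suc (toℕ i)))) ≡⟨ xPosition-xPath _ (s≤s i<M) ⟩
      suc (suc (toℕ i))                  ∎)
      where open ≡-Reasoning

  xc-neighbours : (i : Fin (N ∸ k)) (j : Fin (k + toℕ i)) → ExactNeighboursᴰ (xc i j) (x i ∷ xd i j ∷ [])
  xc-neighbours i j = record
    { distinct = ((λ ()) ∷ []) ∷ [] ∷ []
    ; adjacent = inj₂ (e-xc i j) ∷ inj₁ (e-xcd i j) ∷ []
    ; complete = λ { (inj₁ (e-xcd _ _)) → there (here refl) ; (inj₂ (e-xc _ _)) → here refl }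
    }

  xd-neighbours : (i : Fin (N ∸ k)) (j : Fin (k + toℕ i)) → ExactNeighboursᴰ (xd i j) (xc i j ∷ [])
  xd-neighbours i j = record
    { distinct = [] ∷ []
    ; adjacent = inj₂ (e-xcd i j) ∷ []
    ; complete = λ { (inj₂ (e-xcd _ _)) → here refl }
    }

  a-neighbours : (i : Fin N) → ExactNeighboursᴰ (a i) (z ∷ b i ∷ tabulate (ac i))
  a-neighbours i = record
    { distinct = ((λ ()) ∷ All.tabulate⁺ (λ _ ()))
               ∷ All.tabulate⁺ (λ _ ())
               ∷ Unique.tabulate⁺ λ { refl → refl }
    ; adjacent = inj₂ (e-za i) ∷ inj₁ (e-ab i) ∷ All.tabulate⁺ (λ j → inj₁ (e-ac i j))
    ; complete = λ
        { (inj₁ (e-ab _))   → there (here refl)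
        ; (inj₁ (e-ac _ j)) → there (there (∈-tabulate⁺ j))
        ; (inj₂ (e-za _))   → here refl
        }
    }

  ac-neighbours : (i : Fin N) (j : Fin (N + toℕ i)) → ExactNeighboursᴰ (ac i j) (a i ∷ ad i j ∷ [])
  ac-neighbours i j = record
    { distinct = ((λ ()) ∷ []) ∷ [] ∷ []
    ; adjacent = inj₂ (e-ac i j) ∷ inj₁ (e-acd i j) ∷ []
    ; complete = λ { (inj₁ (e-acd _ _)) → there (here refl) ; (inj₂ (e-ac _ _)) → here refl }
    }

  ad-neighbours : (i : Fin N) (j : Fin (N + toℕ i)) → ExactNeighboursᴰ (ad i j) (ac i j ∷ [])
  ad-neighbours i j = record
    { distinct = [] ∷ []
    ; adjacent = inj₂ (e-acd i j) ∷ []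
    ; complete = λ { (inj₂ (e-acd _ _)) → here refl }
    }

  b-neighbours : (i : Fin N) → ExactNeighboursᴰ (b i) (z ∷ a i ∷ tabulate (bc i))
  b-neighbours i = record
    { distinct = ((λ ()) ∷ All.tabulate⁺ (λ _ ()))
               ∷ All.tabulate⁺ (λ _ ())
               ∷ Unique.tabulate⁺ λ { refl → refl }
    ; adjacent = inj₂ (e-zb i) ∷ inj₂ (e-ab i) ∷ All.tabulate⁺ (λ j → inj₁ (e-bc i j))
    ; complete = λ
        { (inj₁ (e-bc _ j)) → there (there (∈-tabulate⁺ j))
        ; (inj₂ (e-zb _))   → here refl
        ; (inj₂ (e-ab _))   → there (here refl)
        }
    }

  bc-neighbours : (i : Fin N) (j : Fin (N + toℕ i)) → ExactNeighboursᴰ (bc i j) (b i ∷ bd i j ∷ [])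
  bc-neighbours i j = record
    { distinct = ((λ ()) ∷ []) ∷ [] ∷ []
    ; adjacent = inj₂ (e-bc i j) ∷ inj₁ (e-bcd i j) ∷ []
    ; complete = λ { (inj₁ (e-bcd _ _)) → there (here refl) ; (inj₂ (e-bc _ _)) → here refl }
    }

  bd-neighbours : (i : Fin N) (j : Fin (N + toℕ i)) → ExactNeighboursᴰ (bd i j) (bc i j ∷ [])
  bd-neighbours i j = record
    { distinct = [] ∷ []
    ; adjacent = inj₂ (e-bcd i j) ∷ []
    ; complete = λ { (inj₂ (e-bcd _ _)) → here refl }
    }

  gadgetVertices : List (DV N k p t)
  gadgetVertices = map a (allFin N) ++ map b (allFin N)

  gadgetVertices-distinct : Unique gadgetVertices
  gadgetVertices-distinct =
    Unique.++⁺ (Unique.map⁺ (λ { refl → refl }) (Unique.allFin⁺ N))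
               (Unique.map⁺ (λ { refl → refl }) (Unique.allFin⁺ N))
               (λ (u∈as , u∈bs) → a≢b u∈as u∈bs)
    where
    a≢b : ∀ {u} → u ∈ map a (allFin N) → u ∈ map b (allFin N) → ⊥
    a≢b u∈as u∈bs with ∈-map⁻ a u∈as | ∈-map⁻ b u∈bs
    ... | _ , _ , refl | _ , _ , ()

  gadgetVertices-adjacent : All (DAdj z) gadgetVertices
  gadgetVertices-adjacent =
    All.++⁺ (All.map⁺ (All.tabulate⁺ (inj₁ ∘ e-za))) (All.map⁺ (All.tabulate⁺ (inj₁ ∘ e-zb)))

  length-gadgetVertices : length gadgetVertices ≡ N + N
  length-gadgetVertices = trans (length-++ (map a (allFin N)))
    (cong₂ _+_ (trans (length-map a (allFin N)) (length-tabulate {n = N} id))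
               (trans (length-map b (allFin N)) (length-tabulate {n = N} id)))

-- Exchanging the two arms

swapArms : ∀ {N k p t} → DV N k p t → DV N p k t
swapArms v        = v
swapArms z        = z
swapArms (x i)    = y i
swapArms (xc i j) = yc i j
swapArms (xd i j) = yd i j
swapArms (y i)    = x i
swapArms (yc i j) = xc i j
swapArms (yd i j) = xd i j
swapArms (vp j)   = vp j
swapArms (vc j)   = vc j
swapArms (vd j)   = vd j
swapArms (a i)    = a i
swapArms (b i)    = b i
swapArms (ac i j) = ac i j
swapArms (ad i j) = ad i j
swapArms (bc i j) = bc i j
swapArms (bd i j) = bd i j

swapArms-involutive : ∀ {N k p t} (u : DV N k p t) → swapArms (swapArms u) ≡ u
swapArms-involutive v        = refl
swapArms-involutive z        = refl
swapArms-involutive (x i)    = refl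
swapArms-involutive (xc i j) = refl
swapArms-involutive (xd i j) = refl
swapArms-involutive (y i)    = refl
swapArms-involutive (yc i j) = refl
swapArms-involutive (yd i j) = refl
swapArms-involutive (vp j)   = refl
swapArms-involutive (vc j)   = refl
swapArms-involutive (vd j)   = refl
swapArms-involutive (a i)    = refl
swapArms-involutive (b i)    = refl
swapArms-involutive (ac i j) = refl
swapArms-involutive (ad i j) = refl
swapArms-involutive (bc i j) = refl
swapArms-involutive (bd i j) = refl

swapArms-edge : ∀ {N k p t} {u u′ : DV N k p t} → DE u u′ → DE (swapArms u) (swapArms u′)
swapArms-edge (e-vx i i≡0)    = e-vy i i≡0
swapArms-edge (e-xx i j i+1≡j) = e-yy i j i+1≡j
swapArms-edge (e-xz i last)   = e-yz i last
swapArms-edge (e-xc i j)      = e-yc i j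
swapArms-edge (e-xcd i j)     = e-ycd i j
swapArms-edge (e-vy i i≡0)    = e-vx i i≡0
swapArms-edge (e-yy i j i+1≡j) = e-xx i j i+1≡j
swapArms-edge (e-yz i last)   = e-xz i last
swapArms-edge (e-yc i j)      = e-xc i j
swapArms-edge (e-ycd i j)     = e-xcd i j
swapArms-edge (e-vp j)        = e-vp j
swapArms-edge (e-vc j)        = e-vc j
swapArms-edge (e-vcd j)       = e-vcd j
swapArms-edge (e-za i)        = e-za i
swapArms-edge (e-zb i)        = e-zb i
swapArms-edge (e-ab i)        = e-ab i
swapArms-edge (e-ac i j)      = e-ac i j
swapArms-edge (e-acd i j)     = e-acd i j
swapArms-edge (e-bc i j)      = e-bc i j
swapArms-edge (e-bcd i j)     = e-bcd i j

swapArms-adj : ∀ {N k p t} {u u′ : DV N k p t} → DAdj u u′ → DAdj (swapArms u) (swapArms u′)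
swapArms-adj = Sum.map swapArms-edge swapArms-edge

swapArms-attached : ∀ {N k p t H f} →
                    AttachedInduced N k p t H f → AttachedInduced N p k t H (f ∘ swapArms)
swapArms-attached {f = f} attached = record
  { inj      = λ {u} {u′} e → begin
      u                        ≡⟨ sym (swapArms-involutive u) ⟩
      swapArms (swapArms u)    ≡⟨ cong swapArms (inj e) ⟩
      swapArms (swapArms u′)   ≡⟨ swapArms-involutive u′ ⟩
      u′                       ∎
  ; adj→D    = λ u u′ e →
      subst₂ DAdj (swapArms-involutive u) (swapArms-involutive u′) (swapArms-adj (adj→D _ _ e))
  ; D→adj    = λ u u′ → D→adj _ _ ∘ swapArms-adj
  ; boundary = λ u h h∉im uh → Sum.map (unswap u) (unswap u)
      (boundary (swapArms u) h
        (λ u′ → subst (λ u″ → f u″ ≢ h) (swapArms-involutive u′) (h∉im (swapArms u′))) uh)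
  }
  where
  open AttachedInduced attached
  open ≡-Reasoning
  unswap : ∀ u {c} → swapArms u ≡ c → u ≡ swapArms c
  unswap u e = trans (sym (swapArms-involutive u)) (cong swapArms e)

-- A proper weighting of H seen on D

module Embedded {N k p t : ℕ} {H : Graph} {f : DV N k p t → Fin (n H)}
                (attached : AttachedInduced N k p t H f) (ω : Weight H) (proper : Proper H ω) where

  open AttachedInduced attached

  wᴰ : DV N k p t → DV N k p t → ℕ
  wᴰ u u′ = w ω (f u) (f u′)

  colorᴰ : DV N k p t → ℕ
  colorᴰ u = color H ω (f u)

  wᴰ-sym : ∀ u u′ → wᴰ u u′ ≡ wᴰ u′ u
  wᴰ-sym u u′ = w-sym ω (f u) (f u′)

  wᴰ≤1 : ∀ u u′ → wᴰ u u′ ≤ 1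
  wᴰ≤1 u u′ = w≤1 ω (f u) (f u′)

  properᴰ : ∀ {u u′} → DAdj u u′ → colorᴰ u ≢ colorᴰ u′
  properᴰ u~u′ = proper _ _ (D→adj _ _ u~u′)

  private
    sum-wᴰ : ∀ u L → sum (map (w ω (f u)) (map f L)) ≡ sum (map (wᴰ u) L)
    sum-wᴰ u L = cong sum (sym (map-∘ L))

    distinct-in-H : ∀ {L} → Unique L → Unique (map f L)
    distinct-in-H = Unique.map⁺ inj

    adjacent-in-H : ∀ {u L} → All (DAdj u) L → All (Adj H (f u)) (map f L)
    adjacent-in-H = All.map⁺ ∘ All.map (D→adj _ _)

  exact-in-H : ∀ {u L} ⦃ _ : Interior u ⦄ →
               ExactNeighboursᴰ u L → ExactNeighbours (Adj H) (f u) (map f L)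
  exact-in-H {u} {L} ⦃ interior ⦄ exact = record
    { distinct = distinct-in-H distinct
    ; adjacent = adjacent-in-H adjacent
    ; complete = complete-in-H
    }
    where
    open ExactNeighbours exact
    open DecMembership (_≟ᶠ_ {n H}) using (_∈?_)
    complete-in-H : ∀ {h} → Adj H (f u) h → h ∈ map f L
    complete-in-H {h} uh with h ∈? map f L
    ... | yes h∈fL = h∈fL
    ... | no  h∉fL = ⊥-elim (Sum.[ (λ u≡v → subst Interior u≡v interior)
                                 , (λ u≡z → subst Interior u≡z interior) ]
                               (boundary u h outside-image uh))
      where
      outside-image : ∀ u′ → f u′ ≢ h
      outside-image u′ fu′≡h =
        h∉fL (subst (_∈ map f L) fu′≡h
                (∈-map⁺ f (complete (adj→D u u′ (subst (Adj H (f u)) (sym fu′≡h) uh)))))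

  colorᴰ-exact : ∀ {u L} ⦃ _ : Interior u ⦄ → ExactNeighboursᴰ u L → colorᴰ u ≡ sum (map (wᴰ u) L)
  colorᴰ-exact {u} {L} exact = trans (color-exact H ω (exact-in-H exact)) (sum-wᴰ u L)

  weightsᴰ≤colorᴰ : ∀ {u L} → Unique L → All (DAdj u) L → sum (map (wᴰ u) L) ≤ colorᴰ u
  weightsᴰ≤colorᴰ {u} {L} uniqL adjL =
    subst (_≤ colorᴰ u) (sum-wᴰ u L) (weights≤color H ω (distinct-in-H uniqL) (adjacent-in-H adjL))

  colorᴰ+length≤weightsᴰ+deg : ∀ {u L} → Unique L → All (DAdj u) L →
                               colorᴰ u + length L ≤ sum (map (wᴰ u) L) + deg H (f u)
  colorᴰ+length≤weightsᴰ+deg {u} {L} uniqL adjL =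
    subst₂ _≤_ (cong (colorᴰ u +_) (length-map f L)) (cong (_+ deg H (f u)) (sum-wᴰ u L))
      (color+length≤weights+deg H ω (distinct-in-H uniqL) (adjacent-in-H adjL))

  suspended-weight : ∀ {u c d} ⦃ _ : Interior c ⦄ ⦃ _ : Interior d ⦄ →
                     ExactNeighboursᴰ c (u ∷ d ∷ []) → ExactNeighboursᴰ d (c ∷ []) → wᴰ u c ≡ 1
  suspended-weight {u} {c} {d} c-nbrs d-nbrs with n≤1⇒n≡0∨n≡1 (wᴰ≤1 u c)
  ... | inj₂ uc≡1 = uc≡1
  ... | inj₁ uc≡0 = ⊥-elim (properᴰ (All.head (ExactNeighbours.adjacent d-nbrs)) (begin
    colorᴰ d            ≡⟨ colorᴰ-exact d-nbrs ⟩
    wᴰ d c + 0          ≡⟨ cong (_+ 0) (wᴰ-sym d c) ⟩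
    wᴰ c d + 0          ≡⟨ cong (_+ (wᴰ c d + 0)) (sym (trans (wᴰ-sym c u) uc≡0)) ⟩
    wᴰ c u + (wᴰ c d + 0) ≡⟨ sym (colorᴰ-exact c-nbrs) ⟩
    colorᴰ c            ∎))
    where open ≡-Reasoning

  colorᴰ-with-suspended-paths : ∀ {u u₁ u₂ m} {c : Fin m → DV N k p t} ⦃ _ : Interior u ⦄ →
                                ExactNeighboursᴰ u (u₁ ∷ u₂ ∷ tabulate c) → (∀ j → wᴰ u (c j) ≡ 1) →
                                colorᴰ u ≡ wᴰ u u₁ + wᴰ u u₂ + m
  colorᴰ-with-suspended-paths {u} {u₁} {u₂} {m} {c} exact path-weight = begin
    colorᴰ u                                          ≡⟨ colorᴰ-exact exact ⟩
    wᴰ u u₁ + (wᴰ u u₂ + sum (map (wᴰ u) (tabulate c))) ≡⟨ cong (λ s → wᴰ u u₁ + (wᴰ u u₂ + s)) paths ⟩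
    wᴰ u u₁ + (wᴰ u u₂ + m)                           ≡⟨ sym (+-assoc (wᴰ u u₁) _ m) ⟩
    wᴰ u u₁ + wᴰ u u₂ + m                             ∎
    where
    open ≡-Reasoning
    paths : sum (map (wᴰ u) (tabulate c)) ≡ m
    paths = trans (sum-map-const (All.tabulate⁺ path-weight)) (trans (*-identityʳ _) (length-tabulate c))

  gadget-at-z : (i : Fin N) → wᴰ z (a i) + wᴰ z (b i) ≡ 1 × colorᴰ z ≢ suc (N + toℕ i)
  gadget-at-z i = gadget-arith (wᴰ≤1 z (a i)) (wᴰ≤1 z (b i)) (wᴰ≤1 (a i) (b i))
    (λ e → properᴰ (inj₁ (e-ab i)) (trans colorA (trans e (sym colorB))))
    (λ e → properᴰ (inj₁ (e-za i)) (trans e (sym colorA)))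
    (λ e → properᴰ (inj₁ (e-zb i)) (trans e (sym colorB)))
    where
    colorA : colorᴰ (a i) ≡ wᴰ z (a i) + wᴰ (a i) (b i) + (N + toℕ i)
    colorA = trans (colorᴰ-with-suspended-paths (a-neighbours i)
                      (λ j → suspended-weight (ac-neighbours i j) (ad-neighbours i j)))
                   (cong (λ α → α + wᴰ (a i) (b i) + (N + toℕ i)) (wᴰ-sym (a i) z))
    colorB : colorᴰ (b i) ≡ wᴰ z (b i) + wᴰ (a i) (b i) + (N + toℕ i)
    colorB = trans (colorᴰ-with-suspended-paths (b-neighbours i)
                      (λ j → suspended-weight (bc-neighbours i j) (bd-neighbours i j)))
                   (cong₂ (λ β γ → β + γ + (N + toℕ i)) (wᴰ-sym (b i) z) (wᴰ-sym (b i) (a i)))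

  gadget-sum : sum (map (wᴰ z) gadgetVertices) ≡ N
  gadget-sum = begin
    sum (map (wᴰ z) (map a all ++ map b all))                    ≡⟨ cong sum (map-++ (wᴰ z) (map a all) _) ⟩
    sum (map (wᴰ z) (map a all) ++ map (wᴰ z) (map b all))       ≡⟨ sum-++ (map (wᴰ z) (map a all)) _ ⟩
    sum (map (wᴰ z) (map a all)) + sum (map (wᴰ z) (map b all))  ≡⟨ cong₂ _+_ (cong sum (sym (map-∘ all)))
                                                                               (cong sum (sym (map-∘ all))) ⟩
    sum (map (wᴰ z ∘ a) all) + sum (map (wᴰ z ∘ b) all)          ≡⟨ sum-map-+ all ⟩
    sum (map (λ i → wᴰ z (a i) + wᴰ z (b i)) all)                ≡⟨ sum-map-const (All.tabulate⁺ (proj₁ ∘ gadget-at-z)) ⟩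
    length all * 1                                               ≡⟨ *-identityʳ _ ⟩
    length all                                                   ≡⟨ length-tabulate id ⟩
    N                                                            ∎
    where
    open ≡-Reasoning
    all = allFin N

  nongadget-edge-at-z : ∀ {u} → DAdj z u → (∀ i → u ≢ a i) → (∀ i → u ≢ b i) → deg H (f z) ≤ 3 * N →
                        wᴰ z u ≡ 0 × colorᴰ z ≡ N
  nongadget-edge-at-z {u} z~u u≢a u≢b deg≤3N =
    n≤0⇒n≡0 (+-cancelʳ-≤ N e 0 (≤-trans e+N≤c c≤N)) , ≤-antisym c≤N (≤-trans (m≤n+m N e) e+N≤c)
    where
    e = wᴰ z u
    c = colorᴰ z
    L = u ∷ gadgetVertices
    distinctL : Unique L
    distinctL = All.++⁺ (All.map⁺ (All.tabulate⁺ u≢a)) (All.map⁺ (All.tabulate⁺ u≢b))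
              ∷ gadgetVertices-distinct
    adjacentL : All (DAdj z) L
    adjacentL = z~u ∷ gadgetVertices-adjacent
    sumL : sum (map (wᴰ z) L) ≡ e + N
    sumL = cong (e +_) gadget-sum
    e+N≤c : e + N ≤ c
    e+N≤c = subst (_≤ c) sumL (weightsᴰ≤colorᴰ distinctL adjacentL)
    degree-count : ∀ N → 1 + N + 3 * N ≡ N + N + suc (N + N)
    degree-count = solve-∀
    c≤2N : c ≤ N + N
    c≤2N = +-cancelʳ-≤ (suc (N + N)) c (N + N) (begin
      c + suc (N + N)                   ≡⟨ cong (λ l → c + suc l) (sym (length-gadgetVertices {N} {k} {p} {t})) ⟩
      c + length L                      ≤⟨ colorᴰ+length≤weightsᴰ+deg distinctL adjacentL ⟩
      sum (map (wᴰ z) L) + deg H (f z)  ≡⟨ cong (_+ deg H (f z)) sumL ⟩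
      e + N + deg H (f z)               ≤⟨ +-mono-≤ (+-monoˡ-≤ N (wᴰ≤1 z u)) deg≤3N ⟩
      1 + N + 3 * N                     ≡⟨ degree-count N ⟩
      N + N + suc (N + N)               ∎)
      where open ≤-Reasoning
    c≤N : c ≤ N
    c≤N = below-gap c≤2N (proj₂ ∘ gadget-at-z)

  xEdgeWeight xColor : ℕ → ℕ
  xEdgeWeight m = wᴰ (xPath m) (xPath (suc m))
  xColor      m = colorᴰ (xPath (suc m))

  xColor-path : ∀ m → m < N ∸ k → xColor m ≡ xEdgeWeight m + xEdgeWeight (suc m) + (k + m)
  xColor-path m m<M =
    subst (λ m → xColor m ≡ xEdgeWeight m + xEdgeWeight (suc m) + (k + m))
          (toℕ-fromℕ< m<M) (x-color (fromℕ< m<M))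
    where
    x-color : (i : Fin (N ∸ k)) →
              xColor (toℕ i) ≡ xEdgeWeight (toℕ i) + xEdgeWeight (suc (toℕ i)) + (k + toℕ i)
    x-color i =
      subst (λ u → colorᴰ u ≡ wᴰ (xPath (toℕ i)) u + wᴰ u (xPath (suc (suc (toℕ i)))) + (k + toℕ i))
        (sym (xPath-x i))
        (trans (colorᴰ-with-suspended-paths (x-neighbours i)
                  (λ j → suspended-weight (xc-neighbours i j) (xd-neighbours i j)))
               (cong (λ α → α + wᴰ (x i) (xPath (suc (suc (toℕ i)))) + (k + toℕ i))
                     (wᴰ-sym (x i) (xPath (toℕ i)))))

  x-arm-start : k < N → deg H (f z) ≤ 3 * N → (i : Fin (N ∸ k)) → toℕ i ≡ 0 →
                wᴰ v (x i) ≡ 0 × colorᴰ (x i) ≡ k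
  x-arm-start k<N deg≤3N i i≡0 =
    subst (λ u → wᴰ v u ≡ 0) first (proj₁ start) ,
    trans (cong colorᴰ (sym first)) (trans (proj₂ start) (+-identityʳ k))
    where
    M = N ∸ k
    0<M = m<n⇒0<n∸m k<N
    at-z : wᴰ z (xPath M) ≡ 0 × colorᴰ z ≡ N
    at-z = nongadget-edge-at-z (Sum.swap (subst (DAdj (xPath M)) xPath-end (xPath-adjacent 0<M M ≤-refl)))
                               (λ _ → xPath-≢ M refl) (λ _ → xPath-≢ M refl) deg≤3N
    last-weight : xEdgeWeight M ≡ 0
    last-weight = trans (cong (wᴰ (xPath M)) xPath-end) (trans (wᴰ-sym (xPath M) z) (proj₁ at-z))
    color-z : xColor M ≡ k + M
    color-z = trans (cong colorᴰ xPath-end) (trans (proj₂ at-z) (sym (m+[n∸m]≡n (<⇒≤ k<N))))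
    start : xEdgeWeight 0 ≡ 0 × xColor 0 ≡ k + 0
    start = weights-vanish-along-path xEdgeWeight xColor
              (λ m → wᴰ≤1 (xPath m) (xPath (suc m))) xColor-path
              (λ m m<M → properᴰ (xPath-adjacent 0<M (suc m) m<M)) last-weight color-z z≤n
    first : xPath 1 ≡ x i
    first = trans (cong (xPath ∘ suc) (sym i≡0)) (xPath-x i)

mainTheorem8 : (N k p t : ℕ) → 1 ≤ k → 1 ≤ p → 2 ≤ t → k < N → p < N →
    (H : Graph) (f : DV N k p t → Fin (n H)) → AttachedInduced N k p t H f →
    deg H (f z) ≤ 3 * N →
    (ω : Weight H) → Proper H ω →
    (i : Fin (N ∸ k)) (j : Fin (N ∸ p)) → toℕ i ≡ 0 → toℕ j ≡ 0 →
    (w ω (f v) (f (x i)) ≡ 0) × (w ω (f v) (f (y j)) ≡ 0) ×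
    (color H ω (f (x i)) ≡ k) × (color H ω (f (y j)) ≡ p)
mainTheorem8 N k p t _ _ _ k<N p<N H f attached deg≤3N ω proper i j i≡0 j≡0 =
  let (vx≡0 , colx≡k) = Embedded.x-arm-start attached ω proper k<N deg≤3N i i≡0
      (vy≡0 , coly≡p) = Embedded.x-arm-start (swapArms-attached attached) ω proper p<N deg≤3N j j≡0
  in  vx≡0 , vy≡0 , colx≡k , coly≡p
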